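{- For every integer $q\ge 2$, the graph $\overline{KE_q}$ has a frozen $3q$-clique-partition.
   Context: For $q\ge 1$, $\overline{KE_q}$ is the graph with the $6q$ vertices $v_{i1},v_{i2},v_{i3}$ ($i=1,\dots,2q$), whose edges are: the edges of the Hamiltonian cycle $v_{11},v_{12},v_{13},v_{21},v_{22},v_{23},\dots,v_{2q\,1},v_{2q\,2},v_{2q\,3},v_{11}$; the edges $v_{i1}v_{i3}$ for $i=1,\dots,2q$ (so each $\{v_{i1},v_{i2},v_{i3}\}$ is a triangle); and the edges $v_{i2}v_{i+q\,2}$ for $i=1,\dots,q$. A $k$-clique-partition is a partition of the vertex set into at most $k$ (ordered, possibly empty) cliques; it is frozen if every vertex $v$ has a non-neighbour in each of the $k$ cliques other than the one containing $v$. -}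

module Defs where

open import Data.Nat using (ℕ; _+_; _*_)
import Data.Nat as ℕ
open import Data.Fin using (Fin; toℕ; zero; suc)
open import Data.Product using (_×_; _,_; ∃-syntax)
open import Data.Sum using (_⊎_)
open import Relation.Nullary using (¬_)
open import Relation.Binary.PropositionalEquality using (_≡_; _≢_)

-- Vertex v_{i a} of KE̅_q, 0-indexed: i ∈ {0..2q-1} (paper: i+1), a ∈ {0,1,2} (paper: a+1).
Vertex : ℕ → Set
Vertex q = Fin (2 * q) × Fin 3

NextIdx : (q : ℕ) → Fin (2 * q) → Fin (2 * q) → Set
NextIdx q i j = (ℕ.suc (toℕ i) ≡ toℕ j) ⊎ (ℕ.suc (toℕ i) ≡ 2 * q × toℕ j ≡ 0)

data Edge (q : ℕ) : Vertex q → Vertex q → Set where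
  -- triangle {v_i1, v_i2, v_i3} (contains the cycle edges inside a block and v_i1 v_i3)
  triangle : ∀ i a b → a ≢ b → Edge q (i , a) (i , b)
  cycle : ∀ i j → NextIdx q i j → Edge q (i , suc (suc zero)) (j , zero)
  match : ∀ i j → toℕ j ≡ toℕ i + q → Edge q (i , suc zero) (j , suc zero)

Adj : (q : ℕ) → Vertex q → Vertex q → Set
Adj q u v = Edge q u v ⊎ Edge q v u

-- a k-clique-partition: assignment of each vertex to one of k (ordered, possibly empty)
-- parts, each part being a clique
IsCliquePartition : (q k : ℕ) → (Vertex q → Fin k) → Set
IsCliquePartition q k c = ∀ u v → u ≢ v → c u ≡ c v → Adj q u v

IsFrozen : (q k : ℕ) → (Vertex q → Fin k) → Set
IsFrozen q k c = ∀ v (j : Fin k) → j ≢ c v →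
  ∃[ u ] (c u ≡ j × u ≢ v × ¬ Adj q u v)

{-# OPTIONS --safe #-}
module Submission where

-- The 3q edges between different triangles (the cycle edges v_{i3} v_{i+1,1} and the
-- matching edges v_{i2} v_{i+q,2}) form a perfect matching; take them as the cliques.
-- Every vertex has only one neighbour outside its own triangle. So if v lies outside
-- the class {u, w} and in u's triangle, an edge vw would make v the outside neighbour
-- of w, i.e. v = u; and if v is not in u's triangle, an edge uv would force v = w.

open import Defs
open import Data.Nat using (ℕ; _≥_; _*_)
open import Data.Fin using (Fin)
open import Data.Product using (_×_; ∃-syntax)

open import Data.Nat as ℕ using (suc; _+_)
open import Data.Nat.Properties
  using (suc-injective; 1+n≢n; m*n≡1⇒m≡1; +-cancelʳ-≡; +-comm; +-identityʳ;
         +-monoˡ-≤; m≤n+m; <⇒≱; ≤-reflexive; ≤-antisym; 1+n≢0; ≮⇒≥; module ≤-Reasoning)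
open import Data.Fin as Fin
  using (toℕ; fromℕ; fromℕ<; inject₁; _↑ˡ_; _↑ʳ_; join; splitAt; quotient; remainder; combine)
open import Data.Fin.Patterns using (0F; 1F; 2F)
open import Data.Fin.Properties
  using (toℕ-injective; toℕ<n; toℕ-fromℕ; toℕ-fromℕ<; toℕ-inject₁; toℕ-↑ˡ; toℕ-↑ʳ;
         splitAt-join; join-splitAt; remQuot-combine; combine-remQuot; combine-injectiveˡ; 0≢1+n)
open import Data.Product using (_,_; proj₁; proj₂)
open import Data.Sum using (_⊎_; inj₁; inj₂; swap)
open import Data.Sum.Properties using (inj₁-injective; inj₂-injective)
open import Data.Empty using (⊥; ⊥-elim)
open import Function using (_∘_)
open import Relation.Nullary using (¬_; yes; no)
open import Relation.Binary.PropositionalEquality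

NextIdx-functional : ∀ {q} {i j j′ : Fin (2 * q)} → NextIdx q i j → NextIdx q i j′ → j ≡ j′
NextIdx-functional (inj₁ i+1≡j) (inj₁ i+1≡j′) = toℕ-injective (trans (sym i+1≡j) i+1≡j′)
NextIdx-functional {j = j} (inj₁ i+1≡j) (inj₂ (i+1≡2q , _)) =
  ⊥-elim (<⇒≱ (toℕ<n j) (≤-reflexive (trans (sym i+1≡2q) i+1≡j)))
NextIdx-functional {j′ = j′} (inj₂ (i+1≡2q , _)) (inj₁ i+1≡j′) =
  ⊥-elim (<⇒≱ (toℕ<n j′) (≤-reflexive (trans (sym i+1≡2q) i+1≡j′)))
NextIdx-functional (inj₂ (_ , j≡0)) (inj₂ (_ , j′≡0)) = toℕ-injective (trans j≡0 (sym j′≡0))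

NextIdx-injective : ∀ {q} {i i′ j : Fin (2 * q)} → NextIdx q i j → NextIdx q i′ j → i ≡ i′
NextIdx-injective (inj₁ i+1≡j) (inj₁ i′+1≡j) = toℕ-injective (suc-injective (trans i+1≡j (sym i′+1≡j)))
NextIdx-injective (inj₁ i+1≡j) (inj₂ (_ , j≡0)) = ⊥-elim (1+n≢0 (trans i+1≡j j≡0))
NextIdx-injective (inj₂ (_ , j≡0)) (inj₁ i′+1≡j) = ⊥-elim (1+n≢0 (trans i′+1≡j j≡0))
NextIdx-injective (inj₂ (i+1≡2q , _)) (inj₂ (i′+1≡2q , _)) =
  toℕ-injective (suc-injective (trans i+1≡2q (sym i′+1≡2q)))

NextIdx-irreflexive : ∀ {q} {i : Fin (2 * q)} → ¬ NextIdx q i i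
NextIdx-irreflexive (inj₁ i+1≡i) = 1+n≢n i+1≡i
NextIdx-irreflexive {q} (inj₂ (i+1≡2q , i≡0)) with m*n≡1⇒m≡1 2 q (trans (sym i+1≡2q) (cong suc i≡0))
... | ()

prev : ∀ q → Fin (2 * q) → Fin (2 * q)
prev (suc _) 0F = fromℕ _
prev (suc _) (Fin.suc i) = inject₁ i

prev-NextIdx : ∀ q (i : Fin (2 * q)) → NextIdx q (prev q i) i
prev-NextIdx (suc _) 0F = inj₂ (cong suc (toℕ-fromℕ _) , refl)
prev-NextIdx (suc _) (Fin.suc i) = inj₁ (cong suc (toℕ-inject₁ i))

prev-injective : ∀ q {i j : Fin (2 * q)} → prev q i ≡ prev q j → i ≡ j
prev-injective q {i} {j} same =
  NextIdx-functional {q} (prev-NextIdx q i) (subst (λ x → NextIdx q x j) (sym same) (prev-NextIdx q j))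

next-exists : ∀ {q} (i : Fin (2 * q)) → ∃[ j ] NextIdx q i j
next-exists {suc p} i with suc (toℕ i) ℕ.<? 2 * suc p
... | yes i+1<2q = fromℕ< i+1<2q , inj₁ (sym (toℕ-fromℕ< i+1<2q))
... | no i+1≮2q = 0F , inj₂ (≤-antisym (toℕ<n i) (≮⇒≥ i+1≮2q) , refl)

no-match-chain : ∀ {q} {i j k : Fin (2 * q)} → toℕ j ≡ toℕ i + q → toℕ k ≡ toℕ j + q → ⊥
no-match-chain {q} {i} {j} {k} j≡i+q k≡j+q = <⇒≱ (toℕ<n k) (begin
  2 * q          ≡⟨ cong (q +_) (+-identityʳ q) ⟩
  q + q          ≤⟨ +-monoˡ-≤ q (m≤n+m q (toℕ i)) ⟩
  toℕ i + q + q  ≡⟨ cong (_+ q) j≡i+q ⟨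
  toℕ j + q      ≡⟨ k≡j+q ⟨
  toℕ k          ∎)
  where open ≤-Reasoning

CrossEdge : ∀ q → Vertex q → Vertex q → Set
CrossEdge q u v = Adj q u v × proj₁ u ≢ proj₁ v

cross-neighbour-unique : ∀ {q} {u v w : Vertex q} → CrossEdge q u v → CrossEdge q u w → v ≡ w
cross-neighbour-unique (inj₁ (triangle _ _ _ _) , u≁v) _ = ⊥-elim (u≁v refl)
cross-neighbour-unique (inj₂ (triangle _ _ _ _) , u≁v) _ = ⊥-elim (u≁v refl)
cross-neighbour-unique _ (inj₁ (triangle _ _ _ _) , u≁w) = ⊥-elim (u≁w refl)
cross-neighbour-unique _ (inj₂ (triangle _ _ _ _) , u≁w) = ⊥-elim (u≁w refl)
cross-neighbour-unique {q} (inj₁ (cycle _ _ i→j) , _) (inj₁ (cycle _ _ i→j′) , _) =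
  cong (_, 0F) (NextIdx-functional {q} i→j i→j′)
cross-neighbour-unique {q} (inj₂ (cycle _ _ j→i) , _) (inj₂ (cycle _ _ j′→i) , _) =
  cong (_, 2F) (NextIdx-injective {q} j→i j′→i)
cross-neighbour-unique (inj₁ (match _ _ j≡i+q) , _) (inj₁ (match _ _ j′≡i+q) , _) =
  cong (_, 1F) (toℕ-injective (trans j≡i+q (sym j′≡i+q)))
cross-neighbour-unique {q} (inj₂ (match _ _ i≡j+q) , _) (inj₂ (match _ _ i≡j′+q) , _) =
  cong (_, 1F) (toℕ-injective (+-cancelʳ-≡ q _ _ (trans (sym i≡j+q) i≡j′+q)))
cross-neighbour-unique (inj₁ (match _ _ j≡i+q) , _) (inj₂ (match _ _ i≡j′+q) , _) =
  ⊥-elim (no-match-chain i≡j′+q j≡i+q)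
cross-neighbour-unique (inj₂ (match _ _ i≡j+q) , _) (inj₁ (match _ _ j′≡i+q) , _) =
  ⊥-elim (no-match-chain i≡j+q j′≡i+q)

frozen-if-classes-are-cross-edges :
  ∀ {q k} (c : Vertex q → Fin k) →
  (∀ j → ∃[ u ] ∃[ w ] (c u ≡ j × c w ≡ j × CrossEdge q u w)) →
  IsFrozen q k c
frozen-if-classes-are-cross-edges {q} c cross-edge v j j≢cv = non-neighbour (cross-edge j)
  where
  outside : ∀ {x} → c x ≡ j → x ≢ v
  outside cx≡j x≡v = j≢cv (trans (sym cx≡j) (cong c x≡v))

  non-neighbour : ∃[ u ] ∃[ w ] (c u ≡ j × c w ≡ j × CrossEdge q u w) →
                  ∃[ x ] (c x ≡ j × x ≢ v × ¬ Adj q x v)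
  non-neighbour (u , w , cu≡j , cw≡j , u~w , u≁w) with proj₁ v Fin.≟ proj₁ u
  ... | no v≁u = u , cu≡j , outside cu≡j , λ u~v →
          outside cw≡j (cross-neighbour-unique (u~w , u≁w) (u~v , v≁u ∘ sym))
  ... | yes v≈u = w , cw≡j , outside cw≡j , λ w~v →
          outside cu≡j (cross-neighbour-unique (swap u~w , u≁w ∘ sym)
                                               (w~v , λ w≈v → u≁w (sym (trans w≈v v≈u))))

combine-matched : ∀ {q} (k : Fin q) → toℕ (combine {2} 1F k) ≡ toℕ (combine {2} 0F k) + q
combine-matched {q} k = begin
  toℕ (q ↑ʳ (k ↑ˡ 0))   ≡⟨ toℕ-↑ʳ q (k ↑ˡ 0) ⟩
  q + toℕ (k ↑ˡ 0)      ≡⟨ cong (q +_) (toℕ-↑ˡ k 0) ⟩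
  q + toℕ k             ≡⟨ +-comm q (toℕ k) ⟩
  toℕ k + q             ≡⟨ cong (_+ q) (toℕ-↑ˡ k (1 * q)) ⟨
  toℕ (k ↑ˡ (1 * q)) + q ∎
  where open ≡-Reasoning

combine-middle-adjacent : ∀ {q} (a b : Fin 2) {k l : Fin q} → k ≡ l →
                          combine a k ≢ combine b l → Adj q (combine a k , 1F) (combine b l , 1F)
combine-middle-adjacent 0F 0F refl a≢b = ⊥-elim (a≢b refl)
combine-middle-adjacent 0F 1F {k} refl _ = inj₁ (match _ _ (combine-matched k))
combine-middle-adjacent 1F 0F {k} refl _ = inj₂ (match _ _ (combine-matched k))
combine-middle-adjacent 1F 1F refl a≢b = ⊥-elim (a≢b refl)

same-remainder-adjacent : ∀ {q} (i j : Fin (2 * q)) → remainder {2} q i ≡ remainder {2} q j →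
                          i ≢ j → Adj q (i , 1F) (j , 1F)
same-remainder-adjacent {q} i j same i≢j =
  subst₂ (λ x y → Adj q (x , 1F) (y , 1F)) (digits i) (digits j)
    (combine-middle-adjacent (quotient {2} q i) (quotient {2} q j) same
      (λ e → i≢j (trans (sym (digits i)) (trans e (digits j)))))
  where
  digits : ∀ x → combine (quotient {2} q x) (remainder q x) ≡ x
  digits = combine-remQuot {2} q

-- Class inj₂ i is the cycle edge leaving triangle i; class inj₁ k is the matching edge on
-- the two indices with remainder k modulo q.
class : ∀ q → Vertex q → Fin q ⊎ Fin (2 * q)
class q (i , 0F) = inj₂ (prev q i)
class q (i , 1F) = inj₁ (remainder {2} q i)
class q (i , 2F) = inj₂ i

same-class-adjacent : ∀ {q} (u v : Vertex q) → u ≢ v → class q u ≡ class q v → Adj q u v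
same-class-adjacent {q} (i , 0F) (j , 0F) u≢v same =
  ⊥-elim (u≢v (cong (_, 0F) (prev-injective q (inj₂-injective same))))
same-class-adjacent {q} (i , 0F) (j , 2F) _ refl = inj₂ (cycle _ _ (prev-NextIdx q i))
same-class-adjacent (i , 1F) (j , 1F) u≢v same =
  same-remainder-adjacent i j (inj₁-injective same) (u≢v ∘ cong (_, 1F))
same-class-adjacent (i , 1F) (j , 2F) _ ()
same-class-adjacent {q} (i , 2F) (j , 0F) _ refl = inj₁ (cycle _ _ (prev-NextIdx q j))
same-class-adjacent (i , 2F) (j , 2F) u≢v refl = ⊥-elim (u≢v refl)

class-cross-edge : ∀ q (x : Fin q ⊎ Fin (2 * q)) →
                   ∃[ u ] ∃[ w ] (class q u ≡ x × class q w ≡ x × CrossEdge q u w)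
class-cross-edge q (inj₁ k) =
  (combine {2} 0F k , 1F) , (combine {2} 1F k , 1F) ,
  cong (inj₁ ∘ proj₂) (remQuot-combine {2} 0F k) , cong (inj₁ ∘ proj₂) (remQuot-combine {2} 1F k) ,
  inj₁ (match _ _ (combine-matched k)) , 0≢1+n ∘ combine-injectiveˡ {2} 0F k 1F k
class-cross-edge q (inj₂ i) with next-exists {q} i
... | j , i→j =
  (i , 2F) , (j , 0F) ,
  refl , cong inj₂ (NextIdx-injective {q} (prev-NextIdx q j) i→j) ,
  inj₁ (cycle i j i→j) , λ i≡j → NextIdx-irreflexive {q} (subst (NextIdx q i) (sym i≡j) i→j)

join-injective : ∀ m n {x y : Fin m ⊎ Fin n} → join m n x ≡ join m n y → x ≡ y
join-injective m n {x} {y} same = begin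
  x                       ≡⟨ splitAt-join m n x ⟨
  splitAt m (join m n x)  ≡⟨ cong (splitAt m) same ⟩
  splitAt m (join m n y)  ≡⟨ splitAt-join m n y ⟩
  y                       ∎
  where open ≡-Reasoning

-- 3 * q reduces to q + 2 * q, so join lands in Fin (3 * q) with no cast.
colouring : ∀ q → Vertex q → Fin (3 * q)
colouring q = join q (2 * q) ∘ class q

colouring-cross-edge : ∀ q (j : Fin (3 * q)) →
  ∃[ u ] ∃[ w ] (colouring q u ≡ j × colouring q w ≡ j × CrossEdge q u w)
colouring-cross-edge q j with class-cross-edge q (splitAt q j)
... | u , w , u∈x , w∈x , uw = u , w , in-j u∈x , in-j w∈x , uw
  where
  in-j : ∀ {v} → class q v ≡ splitAt q j → colouring q v ≡ j
  in-j v∈x = trans (cong (join q (2 * q)) v∈x) (join-splitAt q (2 * q) j)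

-- The construction works for every q.
theorem14 : (q : ℕ) → q ≥ 2 →
    ∃[ c ] (IsCliquePartition q (3 * q) c × IsFrozen q (3 * q) c)
theorem14 q _ =
  colouring q ,
  (λ u v u≢v same → same-class-adjacent u v u≢v (join-injective q (2 * q) same)) ,
  frozen-if-classes-are-cross-edges (colouring q) (colouring-cross-edge q)
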